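{- Let $G$ and $J$ be graphs. If every minimum small common neighbourhood set $S$ of $G \vee J$ satisfies $S \subseteq V(G)$ or $S \subseteq V(J)$, then $c_H(G \vee J) \leq \Upsilon(G \vee J) + 1$.
   Context: The join $G \vee J$ has vertex set $V(G) \cup V(J)$ (disjoint union) and edge set $E(G) \cup E(J) \cup \{uv : u \in V(G), v \in V(J)\}$. For a graph $H$, $N(v)$ is the open neighbourhood of $v$; a non-empty set $S \subseteq V(H)$ is a small common neighbourhood set of $H$ if $\left|\bigcap_{v\in S} N(v)\right| \le |S|$; $\Upsilon(H)$ is the minimum cardinality of such a set, and a minimum small common neighbourhood set is one of cardinality $\Upsilon(H)$. Hyperopic Cops and Robber on $H$ (each vertex considered to carry a loop, so a player may stay put): the cops first occupy a multiset of vertices, then the robber chooses a vertex. In each round, each cop moves to an adjacent vertex or stays, then the robber moves to an adjacent vertex or stays. The robber always sees all cops. The cops see the robber's position except when the robber's vertex is adjacent to every vertex occupied by a cop, in which case the robber is invisible. The robber is captured when a cop occupies the robber's vertex. $c_H(H)$ is the minimum number of cops that can guarantee capture in finitely many moves. -}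

module Defs where

open import Data.Nat using (ℕ; zero; suc; _+_; _≤_)
open import Data.Bool using (Bool; true; false; not; _∨_; if_then_else_)
open import Data.Fin using (Fin; splitAt; _↑ˡ_; _↑ʳ_)
open import Data.Fin.Subset using (Subset; ∣_∣; Nonempty; _⊆_; _∈_)
open import Data.Sum using (_⊎_; inj₁; inj₂)
open import Data.Product using (Σ; ∃; _×_; _,_; proj₁; proj₂)
open import Data.Maybe using (Maybe; just; nothing)
open import Data.List using (List; []; _∷_; allFin)
open import Data.Bool using (_∧_)
open import Data.Vec using (Vec; tabulate; lookup; toList)
import Data.Vec.Membership.Propositional as VM
open import Relation.Binary.PropositionalEquality using (_≡_; refl)

record Graph (n : ℕ) : Set where
  field
    adj   : Fin n → Fin n → Bool
    sym   : ∀ u v → adj u v ≡ adj v u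
    irrefl : ∀ v → adj v v ≡ false
open Graph public

all : ∀ {A : Set} → (A → Bool) → List A → Bool
all p [] = true
all p (x ∷ xs) = p x ∧ all p xs

-- The join G ∨ J on Fin (n + m): vertices x ↑ˡ m come from G,
-- vertices n ↑ʳ y come from J.

joinAdj : ∀ {n m} → Graph n → Graph m → Fin (n + m) → Fin (n + m) → Bool
joinAdj {n} G J x y with splitAt n x | splitAt n y
... | inj₁ a | inj₁ b = adj G a b
... | inj₂ a | inj₂ b = adj J a b
... | inj₁ _ | inj₂ _ = true
... | inj₂ _ | inj₁ _ = true

joinSym : ∀ {n m} (G : Graph n) (J : Graph m) x y → joinAdj G J x y ≡ joinAdj G J y x
joinSym {n} G J x y with splitAt n x | splitAt n y
... | inj₁ a | inj₁ b = sym G a b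
... | inj₂ a | inj₂ b = sym J a b
... | inj₁ _ | inj₂ _ = refl
... | inj₂ _ | inj₁ _ = refl

joinIrrefl : ∀ {n m} (G : Graph n) (J : Graph m) x → joinAdj G J x x ≡ false
joinIrrefl {n} G J x with splitAt n x
... | inj₁ a = irrefl G a
... | inj₂ a = irrefl J a

_∨ᴳ_ : ∀ {n m} → Graph n → Graph m → Graph (n + m)
G ∨ᴳ J = record { adj = joinAdj G J ; sym = joinSym G J ; irrefl = joinIrrefl G J }

isLeft : ∀ {n m} → Fin n ⊎ Fin m → Bool
isLeft (inj₁ _) = true
isLeft (inj₂ _) = false

VG : ∀ n m → Subset (n + m)
VG n m = tabulate (λ x → isLeft (splitAt n x))

VJ : ∀ n m → Subset (n + m)
VJ n m = tabulate (λ x → not (isLeft (splitAt n x)))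

N : ∀ {n} → Graph n → Fin n → Subset n
N H v = tabulate (adj H v)

commonNbhd : ∀ {n} → Graph n → Subset n → Subset n
commonNbhd {n} H S =
  tabulate (λ w → all (λ v → not (lookup S v) ∨ lookup (N H v) w) (allFin n))

IsSCNS : ∀ {n} → Graph n → Subset n → Set
IsSCNS H S = Nonempty S × ∣ commonNbhd H S ∣ ≤ ∣ S ∣

IsUpsilon : ∀ {n} → Graph n → ℕ → Set
IsUpsilon H u =
  (Σ _ λ S → IsSCNS H S × ∣ S ∣ ≡ u) × (∀ S → IsSCNS H S → u ≤ ∣ S ∣)

IsMinSCNS : ∀ {n} → Graph n → ℕ → Subset n → Set
IsMinSCNS H u S = IsSCNS H S × ∣ S ∣ ≡ u

Cops : ℕ → ℕ → Set
Cops n k = Vec (Fin n) k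

Step : ∀ {n} → Graph n → Fin n → Fin n → Set
Step H u v = v ≡ u ⊎ adj H u v ≡ true

LegalCopMove : ∀ {n k} → Graph n → Cops n k → Cops n k → Set
LegalCopMove {k = k} H c c' = ∀ (i : Fin k) → Step H (lookup c i) (lookup c' i)

invisible : ∀ {n k} → Graph n → Cops n k → Fin n → Bool
invisible H c r = all (adj H r) (toList c)

Obs : ℕ → ℕ → Set
Obs n k = Cops n k × Maybe (Fin n)

observe : ∀ {n k} → Graph n → Cops n k → Fin n → Obs n k
observe H c r = c , (if invisible H c r then nothing else just r)

-- a deterministic cop strategy: initial placement, and a move depending on
-- the whole observation history (most recent observation first) and the
-- current cop positions; moves must be legal.
record CopStrategy {n} (H : Graph n) (k : ℕ) : Set where
  field
    start : Cops n k
    move  : List (Obs n k) → Cops n k → Cops n k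
    legal : ∀ h c → LegalCopMove H c (move h c)
open CopStrategy public

-- a robber play: a walk r 0, r 1, … (r 0 is the chosen start vertex,
-- r (suc t) its position after its move in round t).  Since the cops play
-- deterministically and the robber sees everything, quantifying over all
-- walks is the same as quantifying over all robber strategies.
RobberWalk : ∀ {n} → Graph n → Set
RobberWalk {n} H = Σ (ℕ → Fin n) λ r → ∀ t → Step H (r t) (r (suc t))

-- cop positions before round t together with the observation history
-- available to the cops at that moment.
play : ∀ {n k} (H : Graph n) → CopStrategy H k → (ℕ → Fin n) →
       ℕ → Cops n k × List (Obs n k)
play H σ r zero = start σ , (observe H (start σ) (r 0) ∷ [])
play H σ r (suc t) with play H σ r t
... | c , h =
  let c' = move σ h c in
  c' , (observe H c' (r (suc t)) ∷ observe H c' (r t) ∷ h)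

copsAt : ∀ {n k} (H : Graph n) → CopStrategy H k → (ℕ → Fin n) → ℕ → Cops n k
copsAt H σ r t = proj₁ (play H σ r t)

-- capture at round t: a cop is on the robber's vertex either before the
-- cops move in round t (i.e. after the robber's placement / previous move)
-- or right after the cops' move in round t.
CapturedAt : ∀ {n k} (H : Graph n) → CopStrategy H k → (ℕ → Fin n) → ℕ → Set
CapturedAt H σ r t =
  r t VM.∈ copsAt H σ r t ⊎ r t VM.∈ copsAt H σ r (suc t)

CopsWin : ∀ {n} → Graph n → ℕ → Set
CopsWin H k =
  Σ (CopStrategy H k) λ σ → ∀ (w : RobberWalk H) → ∃ λ t → CapturedAt H σ (proj₁ w) t

cH≤ : ∀ {n} → Graph n → ℕ → Set
cH≤ H b = ∃ λ k → k ≤ b × CopsWin H k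

-- Put one cop on each vertex of a minimum small common neighbourhood set S and one more
-- on a vertex e of the other side of the join.  Then every vertex is adjacent to e or to a
-- vertex of S, so a visible robber is caught by the cops' first move.  An invisible robber
-- is adjacent to every cop, hence lies in ⋂_{v ∈ S} N(v); this set has at most |S|
-- vertices, each adjacent to all of S, so the cops on S can occupy all of it at once.
module Submission where

open import Defs hiding (sym)
open import Data.Nat using (ℕ; suc; _+_; _≤_; s≤s)
open import Data.Nat.Properties using (+-comm; ≤-reflexive)
open import Data.Bool using (Bool; true; false; not; _∨_; if_then_else_)
open import Data.Bool.Properties using (not-involutive)
open import Data.Fin using (Fin; zero; suc; splitAt; _↑ˡ_; _↑ʳ_)
open import Data.Fin.Properties using (splitAt-↑ˡ; splitAt-↑ʳ)
open import Data.Fin.Subset using (Subset; ∣_∣; Nonempty; _⊆_; _∈_)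
open import Data.Sum using (_⊎_; inj₁; inj₂)
open import Data.Product using (∃; _×_; _,_)
open import Data.Maybe using (Maybe; just; nothing)
open import Data.List using (List; []; _∷_; allFin)
import Data.List.Membership.Propositional as ListMembership
open import Data.List.Relation.Unary.Any using (here; there)
open import Data.Vec using (Vec; []; _∷_; here; there; lookup; tabulate; toList; map; padRight)
open import Data.Vec.Properties using (lookup∘tabulate; []=⇒lookup; lookup⇒[]=)
import Data.Vec.Membership.Propositional as VecMembership
open import Data.Vec.Membership.Propositional.Properties using (∈-lookup; ∈-map⁺; ∈-toList⁺)
import Data.Vec.Relation.Unary.Any as VecAny
open import Data.Vec.Relation.Unary.Any.Properties using (lookup-index)
open import Relation.Binary.PropositionalEquality using (_≡_; refl; sym; trans; cong; subst)

open ListMembership using () renaming (_∈_ to _∈ₗ_)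
open VecMembership using () renaming (_∈_ to _∈ᵥ_)

all-sound : ∀ {A : Set} (p : A → Bool) xs {x} → all p xs ≡ true → x ∈ₗ xs → p x ≡ true
all-sound p (y ∷ ys) h (here refl) with p y
... | true = refl
all-sound p (y ∷ ys) h (there x∈ys) with p y
... | true = all-sound p ys h x∈ys

all-complete : ∀ {A : Set} (p : A → Bool) xs → (∀ x → p x ≡ true) → all p xs ≡ true
all-complete p [] h = refl
all-complete p (x ∷ xs) h rewrite h x = all-complete p xs h

members : ∀ {n} (p : Subset n) → Vec (Fin n) ∣ p ∣
members [] = []
members (true ∷ p) = zero ∷ map suc (members p)
members (false ∷ p) = map suc (members p)

∈-members⁺ : ∀ {n} {p : Subset n} {x} → x ∈ p → x ∈ᵥ members p
∈-members⁺ {p = true ∷ p} here = VecAny.here refl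
∈-members⁺ {p = true ∷ p} (there x∈p) = VecAny.there (∈-map⁺ suc (∈-members⁺ x∈p))
∈-members⁺ {p = false ∷ p} (there x∈p) = ∈-map⁺ suc (∈-members⁺ x∈p)

∈-padRight⁺ : ∀ {A : Set} {k l} (k≤l : k ≤ l) (a : A) {xs : Vec A k} {x} →
  x ∈ᵥ xs → x ∈ᵥ padRight k≤l a xs
∈-padRight⁺ (s≤s k≤l) a (VecAny.here x≡y) = VecAny.here x≡y
∈-padRight⁺ (s≤s k≤l) a (VecAny.there x∈xs) = VecAny.there (∈-padRight⁺ k≤l a x∈xs)

∈⇒lookup : ∀ {A : Set} {k} {xs : Vec A k} {x} → x ∈ᵥ xs → ∃ λ i → lookup xs i ≡ x
∈⇒lookup x∈xs = VecAny.index x∈xs , sym (lookup-index x∈xs)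

≡-or-≡-not : ∀ a b → a ≡ b ⊎ a ≡ not b
≡-or-≡-not false false = inj₁ refl
≡-or-≡-not false true = inj₂ refl
≡-or-≡-not true false = inj₂ refl
≡-or-≡-not true true = inj₁ refl

∈-commonNbhd⁺ : ∀ {n} (H : Graph n) (S : Subset n) x →
  (∀ v → v ∈ S → adj H v x ≡ true) → x ∈ commonNbhd H S
∈-commonNbhd⁺ {n} H S x adjS =
  lookup⇒[]= x _ (trans (lookup∘tabulate _ x) (all-complete _ (allFin n) adjOrOut))
  where
  adjOrOut : ∀ v → (not (lookup S v) ∨ lookup (N H v) x) ≡ true
  adjOrOut v with lookup S v in v∈S
  ... | false = refl
  ... | true = trans (lookup∘tabulate (adj H v) x) (adjS v (lookup⇒[]= v S v∈S))

invisible⇒adjacent : ∀ {n k} (H : Graph n) (c : Cops n k) x →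
  invisible H c x ≡ true → ∀ i → adj H (lookup c i) x ≡ true
invisible⇒adjacent H c x inv i =
  trans (Graph.sym H (lookup c i) x)
        (all-sound (adj H x) (toList c) inv (∈-toList⁺ (∈-lookup i c)))

Dominates : ∀ {n} → Graph n → Fin n → Subset n → Set
Dominates H e S = ∀ x → adj H e x ≡ true ⊎ ∃ λ s → s ∈ S × adj H s x ≡ true

approach : ∀ {n} (H : Graph n) (c t : Fin n) → Fin n
approach H c t = if adj H c t then t else c

approach-step : ∀ {n} (H : Graph n) c t → Step H c (approach H c t)
approach-step H c t with adj H c t in c~t
... | true = inj₂ c~t
... | false = inj₁ refl

advance : ∀ {n k} (H : Graph n) → Cops n k → (Fin k → Fin n) → Cops n k
advance H c t = tabulate λ i → approach H (lookup c i) (t i)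

advance-legal : ∀ {n k} (H : Graph n) c (t : Fin k → Fin n) → LegalCopMove H c (advance H c t)
advance-legal H c t i =
  subst (Step H (lookup c i)) (sym (lookup∘tabulate _ i)) (approach-step H (lookup c i) (t i))

approach-adjacent : ∀ {n} (H : Graph n) {c t} → adj H c t ≡ true → approach H c t ≡ t
approach-adjacent H c~t rewrite c~t = refl

advance-reaches : ∀ {n k} (H : Graph n) c (t : Fin k → Fin n) i {x} →
  adj H (lookup c i) (t i) ≡ true → t i ≡ x → x ∈ᵥ advance H c t
advance-reaches H c t i c~t refl = subst (_∈ᵥ advance H c t) reached (∈-lookup i (advance H c t))
  where
  reached : lookup (advance H c t) i ≡ t i
  reached = trans (lookup∘tabulate _ i) (approach-adjacent H c~t)

latestSighting : ∀ {n k} → List (Obs n k) → Maybe (Fin n)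
latestSighting [] = nothing
latestSighting ((_ , o) ∷ _) = o

module OneRound {n} (H : Graph n) (e : Fin n) (S : Subset n)
  (small : ∣ commonNbhd H S ∣ ≤ ∣ S ∣) (dominates : Dominates H e S) where

  initial : Cops n (suc ∣ S ∣)
  initial = e ∷ members S

  -- Unseen, the robber is in ⋂ N(S): the cops on S aim at distinct vertices of it
  -- (there are at most |S|), surplus cops at e.
  aim : Maybe (Fin n) → Fin (suc ∣ S ∣) → Fin n
  aim (just x) _ = x
  aim nothing zero = e
  aim nothing (suc i) = lookup (padRight small e (members (commonNbhd H S))) i

  strategy : CopStrategy H (suc ∣ S ∣)
  strategy = record
    { start = initial
    ; move  = λ h c → advance H c (aim (latestSighting h))
    ; legal = λ h c → advance-legal H c (aim (latestSighting h))
    }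

  unseen⇒∈commonNbhd : ∀ x → invisible H initial x ≡ true → x ∈ commonNbhd H S
  unseen⇒∈commonNbhd x inv = ∈-commonNbhd⁺ H S x λ v v∈S →
    let i , i↦v = ∈⇒lookup (∈-members⁺ v∈S) in
    subst (λ w → adj H w x ≡ true) i↦v (invisible⇒adjacent H initial x inv (suc i))

  caughtByFirstMove : ∀ x → x ∈ᵥ advance H initial (aim (latestSighting (observe H initial x ∷ [])))
  caughtByFirstMove x with invisible H initial x in inv
  ... | false with dominates x
  ...   | inj₁ e~x = advance-reaches H initial (aim (just x)) zero e~x refl
  ...   | inj₂ (s , s∈S , s~x) with ∈⇒lookup (∈-members⁺ s∈S)
  ...     | i , refl = advance-reaches H initial (aim (just x)) (suc i) s~x refl
  caughtByFirstMove x | true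
    with ∈⇒lookup (∈-padRight⁺ small e (∈-members⁺ (unseen⇒∈commonNbhd x inv)))
  ... | j , j↦x =
    advance-reaches H initial (aim nothing) (suc j)
      (subst (λ w → adj H (lookup (members S) j) w ≡ true) (sym j↦x)
             (invisible⇒adjacent H initial x inv (suc j)))
      j↦x

  copsWin : CopsWin H (suc ∣ S ∣)
  copsWin = strategy , λ (r , _) → 0 , inj₂ (caughtByFirstMove (r 0))

module JoinSides {n m} (G : Graph n) (J : Graph m) where

  inG : Fin (n + m) → Bool
  inG x = isLeft (splitAt n x)

  join-adj-across : ∀ x y → inG x ≡ not (inG y) → adj (G ∨ᴳ J) x y ≡ true
  join-adj-across x y across with splitAt n x | splitAt n y
  ... | inj₁ _ | inj₂ _ = refl
  ... | inj₂ _ | inj₁ _ = refl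
  join-adj-across x y () | inj₁ _ | inj₁ _
  join-adj-across x y () | inj₂ _ | inj₂ _

  ∈VG⇒inG≡true : ∀ {x} → x ∈ VG n m → inG x ≡ true
  ∈VG⇒inG≡true {x} x∈VG = trans (sym (lookup∘tabulate inG x)) ([]=⇒lookup x∈VG)

  ∈VJ⇒inG≡false : ∀ {x} → x ∈ VJ n m → inG x ≡ false
  ∈VJ⇒inG≡false {x} x∈VJ =
    trans (sym (not-involutive (inG x)))
          (cong not (trans (sym (lookup∘tabulate (λ y → not (inG y)) x)) ([]=⇒lookup x∈VJ)))

  oneSided-dominates : ∀ (b : Bool) e (S : Subset (n + m)) → Nonempty S →
    (∀ {s} → s ∈ S → inG s ≡ b) → inG e ≡ not b → Dominates (G ∨ᴳ J) e S
  oneSided-dominates b e S (s , s∈S) S⊆b e∉b x with ≡-or-≡-not (inG x) b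
  ... | inj₁ x∈b = inj₁ (join-adj-across e x (trans e∉b (cong not (sym x∈b))))
  ... | inj₂ x∉b = inj₂ (s , s∈S , join-adj-across s x
          (trans (S⊆b s∈S) (trans (sym (not-involutive b)) (cong not (sym x∉b)))))

oneSided⇒dominated : ∀ {n m} (G : Graph (suc n)) (J : Graph (suc m)) (S : Subset (suc n + suc m)) →
  Nonempty S → S ⊆ VG (suc n) (suc m) ⊎ S ⊆ VJ (suc n) (suc m) →
  ∃ λ e → Dominates (G ∨ᴳ J) e S
oneSided⇒dominated {n} {m} G J S nonempty (inj₁ S⊆VG) =
  suc n ↑ʳ zero ,
  oneSided-dominates true (suc n ↑ʳ zero) S nonempty (λ s∈S → ∈VG⇒inG≡true (S⊆VG s∈S))
    (cong isLeft (splitAt-↑ʳ (suc n) (suc m) zero))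
  where open JoinSides G J
oneSided⇒dominated {n} {m} G J S nonempty (inj₂ S⊆VJ) =
  zero ↑ˡ suc m ,
  oneSided-dominates false (zero ↑ˡ suc m) S nonempty (λ s∈S → ∈VJ⇒inG≡false (S⊆VJ s∈S))
    (cong isLeft (splitAt-↑ˡ (suc n) zero (suc m)))
  where open JoinSides G J

theorem4p4 : ∀ {n m} (G : Graph (suc n)) (J : Graph (suc m)) (u : ℕ) →
    IsUpsilon (G ∨ᴳ J) u →
    (∀ (S : Subset (suc n + suc m)) → IsMinSCNS (G ∨ᴳ J) u S →
      S ⊆ VG (suc n) (suc m) ⊎ S ⊆ VJ (suc n) (suc m)) →
    cH≤ (G ∨ᴳ J) (u + 1)
theorem4p4 G J u ((S , (nonempty , small) , ∣S∣≡u) , _) oneSided =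
  let e , dominates = oneSided⇒dominated G J S nonempty (oneSided S ((nonempty , small) , ∣S∣≡u))
  in suc ∣ S ∣ , ≤-reflexive (trans (cong suc ∣S∣≡u) (+-comm 1 u)) ,
     OneRound.copsWin (G ∨ᴳ J) e S small dominates
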